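{- Let $n,m\ge1$ and let $C_n$ be the $n$-th Catalan number. The number of words $P$ of length $2n$ over a complementary alphabet with $m$ complementary pairs having exactly $C_n$ $P$-valid plane trees is $2m$; that is, $|N(n,m,C_n)|=2m$.
   Context: A complementary alphabet with $m$ complementary pairs is a set of $2m$ letters in which every letter $B$ has a unique complement $\overline{B}\neq B$ with $\overline{\overline{B}}=B$. A plane tree is a rooted tree with linearly ordered children at each vertex. For a plane tree with $n$ edges, the $2n$ half-edges are labeled $1,\dots,2n$ by starting on the left side of the leftmost root edge and walking counterclockwise; each edge is $e(i,j)$, $i<j$, with $i,j$ the labels of its sides. For $P=p_1\cdots p_{2n}$, a plane tree with $n$ edges is $P$-valid if $p_i,p_j$ are complements for every edge $e(i,j)$; $V(P)$ is the set of $P$-valid plane trees. $N(n,m,k)$ is the set of words $P$ of length $2n$ in the alphabet with $|V(P)|=k$ (and $|V(P)|\ge1$). -}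

module Defs where

open import Data.Nat using (ℕ; zero; suc; _+_; _*_; _/_)
open import Data.Nat.Combinatorics using (_C_)
open import Data.Fin using (Fin)
open import Data.Bool using (Bool; not)
open import Data.Product using (Σ; _×_; _,_)
open import Data.List using (List; []; _∷_; _++_)
open import Data.List.Relation.Unary.All using (All)
open import Data.Maybe using (Maybe; just; nothing)
open import Data.Vec using (Vec; toList)
open import Relation.Binary.PropositionalEquality using (_≡_)

catalan : ℕ → ℕ
catalan n = ((2 * n) C n) / suc n

-- A complementary alphabet with m complementary pairs: 2m letters (i , b),
-- the complement of (i , b) is (i , not b) (no fixed points, an involution).
Letter : ℕ → Set
Letter m = Fin m × Bool

complement : ∀ {m} → Letter m → Letter m
complement (i , b) = (i , not b)

data PlaneTree : Set where
  node : List PlaneTree → PlaneTree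

mutual
  edges : PlaneTree → ℕ
  edges (node cs) = edgesF cs

  edgesF : List PlaneTree → ℕ
  edgesF [] = 0
  edgesF (c ∷ cs) = suc (edges c + edgesF cs)

-- Half-edge labelling by the counterclockwise contour walk (0-based labels:
-- label k here is label k+1 in the paper). The list of pairs (i , j), i < j,
-- one for each edge e(i,j).  'k' is the label of the next half-edge.
mutual
  edgePairs : ℕ → PlaneTree → List (ℕ × ℕ)
  edgePairs k (node cs) = edgePairsF k cs

  edgePairsF : ℕ → List PlaneTree → List (ℕ × ℕ)
  edgePairsF k [] = []
  edgePairsF k (c ∷ cs) =
    ((k , suc (k + 2 * edges c)) ∷ edgePairs (suc k) c)
      ++ edgePairsF (suc (suc (k + 2 * edges c))) cs

at : ∀ {A : Set} → List A → ℕ → Maybe A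
at [] k = nothing
at (x ∷ xs) zero = just x
at (x ∷ xs) (suc k) = at xs k

ComplAt : ∀ {m} → List (Letter m) → ℕ × ℕ → Set
ComplAt {m} P (i , j) =
  Σ (Letter m) λ a → at P i ≡ just a × at P j ≡ just (complement a)

Word : ℕ → ℕ → Set
Word m n = Vec (Letter m) (2 * n)

Valid : ∀ {m n} → Word m n → PlaneTree → Set
Valid P t = All (ComplAt (toList P)) (edgePairs 0 t)

V : ∀ {m n} → Word m n → Set
V {m} {n} P = Σ PlaneTree λ t → edges t ≡ n × Valid {m} {n} P t

module Submission where

-- An edge e(i, j) encloses the contour of the subtree below it, so j − i is
-- odd and every plane tree is valid for the alternating word a ā a ā ⋯.
-- Conversely, V(P) injects into the C_n plane trees with n edges, so
-- |V(P)| = C_n exactly when all of them are P-valid; since some tree has a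
-- leaf edge e(i, i + 1) for every i < 2n − 1, consecutive letters of P are
-- then complementary, and P is one of the 2m alternating words.  That there
-- are C_n plane trees is shown by enumerating (h + 1)-tuples of forests with
-- n edges, which are counted by the ballot numbers C(2n+h, n) − C(2n+h, n−1).

open import Data.Nat using (ℕ; zero; suc; _+_; _*_; _∸_; _/_; _≤_; _<_; z≤n; s≤s)
open import Data.Nat.Properties using (+-identityʳ; *-identityʳ; *-zeroʳ; +-assoc; +-comm; *-comm;
  *-distribˡ-+; +-cancelʳ-≡; +-cancelˡ-≡; m≤m+n; m+n∸n≡m; suc-injective; <-irrefl; ≤-trans; ≤-pred;
  ≤-reflexive; n≤1+n)
open import Data.Nat.Combinatorics using (_C_; nCk+nC[k+1]≡[n+1]C[k+1]; nCk≡nC[n∸k])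
open import Data.Nat.DivMod using (m*n/n≡m)
open import Data.Nat.Tactic.RingSolver using (solve-∀)
open import Data.Bool using (true; false)
open import Data.Bool.Properties using () renaming (_≟_ to _≟ᵇ_)
open import Data.Fin using (Fin; zero; suc)
open import Data.Fin.Properties using () renaming (_≟_ to _≟ᶠ_)
open import Data.Fin.Permutation using (↔⇒≡)
open import Data.List using (List; []; _∷_; _++_; [_]; map; length; filter; lookup; replicate;
  cartesianProduct; allFin)
open import Data.List.Properties using (length-map; length-++; length-tabulate; filter-all; filter-notAll)
open import Data.List.Relation.Unary.All using (All; []; _∷_; all?)
import Data.List.Relation.Unary.All as All
open import Data.List.Relation.Unary.All.Properties using (map⁺; ++⁺; ¬All⇒Any¬)
open import Data.List.Relation.Unary.AllPairs using ([]; _∷_)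
open import Data.List.Relation.Unary.Any using (here; there; index)
open import Data.List.Relation.Unary.Any.Properties using (lookup-index)
open import Data.List.Membership.Propositional using (_∈_)
open import Data.List.Membership.Propositional.Properties
  using (∈-map⁺; ∈-map⁻; ∈-++⁺ˡ; ∈-++⁺ʳ; ∈-filter⁺; ∈-filter⁻; ∈-lookup; ∈-cartesianProduct⁺; ∈-allFin)
open import Data.List.Membership.Propositional.Properties.WithK using (unique⇒irrelevant)
open import Data.List.Relation.Unary.Unique.Propositional using (Unique)
import Data.List.Relation.Unary.Unique.Propositional.Properties as Unique
open import Data.Maybe using (just; nothing)
open import Data.Maybe.Properties using (just-injective) renaming (≡-dec to ≡-decMaybe)
open import Data.Product using (Σ; _×_; _,_; proj₂)
import Data.Product as Product
open import Data.Product.Properties using () renaming (≡-dec to ≡-dec×)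
open import Data.Empty using (⊥)
open import Data.Vec using (Vec; []; _∷_; toList; head)
import Data.Vec as Vec
open import Function using (_∘_; id)
open import Function.Bundles using (_⇔_; _↔_; mk⇔; mk↔ₛ′; Equivalence)
import Function.Properties.Equivalence as ⇔
open import Function.Properties.Inverse using (↔-trans; ↔-sym)
open import Relation.Binary.Definitions using (DecidableEquality)
open import Relation.Binary.PropositionalEquality using (_≡_; refl; sym; trans; cong; cong₂; subst; module ≡-Reasoning)
open import Relation.Binary.PropositionalEquality.WithK using (≡-irrelevant)
open import Relation.Nullary using (yes; no; contradiction)
open import Relation.Nullary.Irrelevant using (Irrelevant)
open import Relation.Unary using (Decidable)
open import Defs

open ≡-Reasoning

2[1+n]≡2+2n : ∀ n → 2 * suc n ≡ suc (suc (2 * n))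
2[1+n]≡2+2n = solve-∀

binomial : ℕ → ℕ → ℕ
binomial _       zero    = 1
binomial zero    (suc k) = 0
binomial (suc N) (suc k) = binomial N k + binomial N (suc k)

binomialPred : ℕ → ℕ → ℕ
binomialPred N zero    = 0
binomialPred N (suc k) = binomial N k

binomial≡C : ∀ N k → binomial N k ≡ N C k
binomial≡C N       zero    = refl
binomial≡C zero    (suc k) = refl
binomial≡C (suc N) (suc k) =
  trans (cong₂ _+_ (binomial≡C N k) (binomial≡C N (suc k))) (nCk+nC[k+1]≡[n+1]C[k+1] N k)

binomial-suc : ∀ N k → binomial (suc N) k ≡ binomialPred N k + binomial N k
binomial-suc N zero    = refl
binomial-suc N (suc k) = refl

binomial-1 : ∀ N → binomial N 1 ≡ N
binomial-1 zero    = refl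
binomial-1 (suc N) = cong suc (binomial-1 N)

binomial-absorption : ∀ N k → suc k * binomial (suc N) (suc k) ≡ suc N * binomial N k
binomial-absorption N zero =
  trans (+-identityʳ _) (trans (binomial-1 (suc N)) (sym (*-identityʳ (suc N))))
binomial-absorption zero    (suc k) = *-zeroʳ (suc (suc k))
binomial-absorption (suc N) (suc k) = begin
  suc (suc k) * ((a + b) + (b + c))               ≡⟨ expand k a b c ⟩
  suc k * (a + b) + (a + b) + suc (suc k) * (b + c)
    ≡⟨ cong₂ (λ x y → x + (a + b) + y) (binomial-absorption N k) (binomial-absorption N (suc k)) ⟩
  suc N * a + (a + b) + suc N * b                 ≡⟨ collect N a b ⟩
  suc (suc N) * (a + b)                           ∎
  where
  a = binomial N k
  b = binomial N (suc k)
  c = binomial N (suc (suc k))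
  expand : ∀ k a b c → suc (suc k) * ((a + b) + (b + c)) ≡ suc k * (a + b) + (a + b) + suc (suc k) * (b + c)
  expand = solve-∀
  collect : ∀ N a b → suc N * a + (a + b) + suc N * b ≡ suc (suc N) * (a + b)
  collect = solve-∀

binomial-middle : ∀ n → binomial (suc (2 * n)) n ≡ binomial (suc (2 * n)) (suc n)
binomial-middle n = begin
  binomial (suc (2 * n)) n     ≡⟨ binomial≡C _ n ⟩
  suc (2 * n) C n              ≡⟨ cong (suc (2 * n) C_) (sym 2n∸n≡n) ⟩
  suc (2 * n) C (2 * n ∸ n)    ≡⟨ sym (nCk≡nC[n∸k] (s≤s (m≤m+n n _))) ⟩
  suc (2 * n) C suc n          ≡⟨ sym (binomial≡C _ (suc n)) ⟩
  binomial (suc (2 * n)) (suc n) ∎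
  where
  2n∸n≡n : 2 * n ∸ n ≡ n
  2n∸n≡n = trans (cong (_∸ n) (cong (n +_) (+-identityʳ n))) (m+n∸n≡m n n)

ballot : ℕ → ℕ → ℕ
ballot zero    h       = 1
ballot (suc n) zero    = ballot n 1
ballot (suc n) (suc h) = ballot (suc n) h + ballot n (suc (suc h))

ballot-binomial : ∀ n h → ballot n h + binomialPred (2 * n + h) n ≡ binomial (2 * n + h) n
ballot-binomial zero h = refl
ballot-binomial (suc n) zero = subst (λ K → ballot n 1 + binomialPred K (suc n) ≡ binomial K (suc n))
  (sym (trans (+-identityʳ (2 * suc n)) (2[1+n]≡2+2n n))) (begin
  ballot n 1 + binomial (suc M) n                   ≡⟨ cong (ballot n 1 +_) (binomial-suc M n) ⟩
  ballot n 1 + (binomialPred M n + binomial M n)    ≡⟨ sym (+-assoc (ballot n 1) _ _) ⟩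
  ballot n 1 + binomialPred M n + binomial M n      ≡⟨ cong (_+ binomial M n) ih ⟩
  binomial M n + binomial M n                       ≡⟨ cong (binomial M n +_) (binomial-middle n) ⟩
  binomial M n + binomial M (suc n)                 ∎)
  where
  M = suc (2 * n)
  ih : ballot n 1 + binomialPred M n ≡ binomial M n
  ih = subst (λ K → ballot n 1 + binomialPred K n ≡ binomial K n) (+-comm (2 * n) 1) (ballot-binomial n 1)
ballot-binomial (suc n) (suc h) = subst (λ K → X + Y + binomialPred K (suc n) ≡ binomial K (suc n))
  (sym (2[1+n]+[1+h]≡1+2[1+n]+h n h)) (begin
  (X + Y) + binomial (suc M) n                  ≡⟨ cong ((X + Y) +_) (binomial-suc M n) ⟩
  (X + Y) + (binomialPred M n + binomial M n)   ≡⟨ +-interchange X Y _ _ ⟩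
  (X + binomial M n) + (Y + binomialPred M n)   ≡⟨ cong₂ _+_ (ballot-binomial (suc n) h) ih ⟩
  binomial M (suc n) + binomial M n             ≡⟨ +-comm (binomial M (suc n)) _ ⟩
  binomial M n + binomial M (suc n)             ∎)
  where
  M = 2 * suc n + h
  X = ballot (suc n) h
  Y = ballot n (suc (suc h))
  2n+[2+h]≡2[1+n]+h : ∀ n h → 2 * n + suc (suc h) ≡ 2 * suc n + h
  2n+[2+h]≡2[1+n]+h = solve-∀
  ih : Y + binomialPred M n ≡ binomial M n
  ih = subst (λ K → Y + binomialPred K n ≡ binomial K n) (2n+[2+h]≡2[1+n]+h n h) (ballot-binomial n (suc (suc h)))
  +-interchange : ∀ x y z w → (x + y) + (z + w) ≡ (x + w) + (y + z)
  +-interchange = solve-∀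
  2[1+n]+[1+h]≡1+2[1+n]+h : ∀ n h → 2 * suc n + suc h ≡ suc (2 * suc n + h)
  2[1+n]+[1+h]≡1+2[1+n]+h = solve-∀

suc-*-ballot : ∀ n → suc n * ballot n 0 ≡ binomial (2 * n) n
suc-*-ballot zero    = refl
suc-*-ballot (suc n) = +-cancelʳ-≡ (suc n * x) (suc (suc n) * c) x (begin
  suc (suc n) * c + suc n * x          ≡⟨ cong (suc (suc n) * c +_) [1+n]x≡[2+n]b ⟩
  suc (suc n) * c + suc (suc n) * b    ≡⟨ sym (*-distribˡ-+ (suc (suc n)) c b) ⟩
  suc (suc n) * (c + b)                ≡⟨ cong (suc (suc n) *_) c+b≡x ⟩
  suc (suc n) * x                      ≡⟨⟩
  x + suc n * x                        ∎)
  where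
  N = 2 * suc n
  b = binomial N n
  x = binomial N (suc n)
  c = ballot (suc n) 0
  c+b≡x : c + b ≡ x
  c+b≡x = subst (λ K → c + binomial K n ≡ binomial K (suc n)) (+-identityʳ N) (ballot-binomial (suc n) 0)
  split : ∀ n b → suc (2 * suc n) * b ≡ suc n * b + suc (suc n) * b
  split = solve-∀
  [1+n]x≡[2+n]b : suc n * x ≡ suc (suc n) * b
  [1+n]x≡[2+n]b = +-cancelˡ-≡ (suc n * b) _ _ (begin
    suc n * b + suc n * x          ≡⟨ sym (*-distribˡ-+ (suc n) b x) ⟩
    suc n * (b + x)                ≡⟨ binomial-absorption N n ⟩
    suc N * b                      ≡⟨ split n b ⟩
    suc n * b + suc (suc n) * b    ∎)

catalan≡ballot : ∀ n → catalan n ≡ ballot n 0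
catalan≡ballot n = begin
  ((2 * n) C n) / suc n             ≡⟨ cong (_/ suc n) (sym (binomial≡C (2 * n) n)) ⟩
  binomial (2 * n) n / suc n        ≡⟨ cong (_/ suc n) (sym (suc-*-ballot n)) ⟩
  (suc n * ballot n 0) / suc n      ≡⟨ cong (_/ suc n) (*-comm (suc n) (ballot n 0)) ⟩
  (ballot n 0 * suc n) / suc n      ≡⟨ m*n/n≡m (ballot n 0) (suc n) ⟩
  ballot n 0                        ∎

ForestTuple : ℕ → Set
ForestTuple h = Vec (List PlaneTree) (suc h)

totalEdges : ∀ {k} → Vec (List PlaneTree) k → ℕ
totalEdges []       = 0
totalEdges (f ∷ fs) = edgesF f + totalEdges fs

graft : ∀ {h} → ForestTuple (suc h) → ForestTuple h
graft (cs ∷ f ∷ fs) = (node cs ∷ f) ∷ fs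

-- A tuple with at least one edge either starts with an empty forest, or
-- its first tree is node cs, and splitting cs off as a new first component
-- leaves a longer tuple with one edge less.
tuples : ℕ → (h : ℕ) → List (ForestTuple h)
tuples zero    h       = [ Vec.replicate (suc h) [] ]
tuples (suc n) zero    = map graft (tuples n 1)
tuples (suc n) (suc h) = map ([] ∷_) (tuples (suc n) h) ++ map graft (tuples n (suc (suc h)))

length-tuples : ∀ n h → length (tuples n h) ≡ ballot n h
length-tuples zero    h       = refl
length-tuples (suc n) zero    = trans (length-map graft (tuples n 1)) (length-tuples n 1)
length-tuples (suc n) (suc h) = begin
  length (map ([] ∷_) (tuples (suc n) h) ++ map graft (tuples n (suc (suc h))))
    ≡⟨ length-++ (map ([] ∷_) (tuples (suc n) h)) ⟩
  length (map ([] ∷_) (tuples (suc n) h)) + length (map graft (tuples n (suc (suc h))))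
    ≡⟨ cong₂ _+_ (length-map ([] ∷_) (tuples (suc n) h)) (length-map graft (tuples n (suc (suc h)))) ⟩
  length (tuples (suc n) h) + length (tuples n (suc (suc h)))
    ≡⟨ cong₂ _+_ (length-tuples (suc n) h) (length-tuples n (suc (suc h))) ⟩
  ballot (suc n) (suc h) ∎

totalEdges-replicate : ∀ k → totalEdges (Vec.replicate k ([] {A = PlaneTree})) ≡ 0
totalEdges-replicate zero    = refl
totalEdges-replicate (suc k) = totalEdges-replicate k

totalEdges≡0⇒replicate : ∀ {k} (v : Vec (List PlaneTree) k) → totalEdges v ≡ 0 → v ≡ Vec.replicate k []
totalEdges≡0⇒replicate []             _  = refl
totalEdges≡0⇒replicate ([] ∷ v)       eq = cong ([] ∷_) (totalEdges≡0⇒replicate v eq)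
totalEdges≡0⇒replicate ((_ ∷ _) ∷ _) ()

totalEdges-graft : ∀ {h} (v : ForestTuple (suc h)) → totalEdges (graft v) ≡ suc (totalEdges v)
totalEdges-graft (cs ∷ f ∷ fs) = cong suc (+-assoc (edgesF cs) (edgesF f) (totalEdges fs))

totalEdges-graft⁻ : ∀ {h n} (v : ForestTuple (suc h)) → totalEdges (graft v) ≡ suc n → totalEdges v ≡ n
totalEdges-graft⁻ v eq = suc-injective (trans (sym (totalEdges-graft v)) eq)

graft-totalEdges : ∀ {h n} {vs : List (ForestTuple (suc h))} →
  All (λ v → totalEdges v ≡ n) vs → All (λ v → totalEdges v ≡ suc n) (map graft vs)
graft-totalEdges = map⁺ ∘ All.map λ {v} eq → trans (totalEdges-graft v) (cong suc eq)

tuples-totalEdges : ∀ n h → All (λ v → totalEdges v ≡ n) (tuples n h)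
tuples-totalEdges zero    h       = totalEdges-replicate (suc h) ∷ []
tuples-totalEdges (suc n) zero    = graft-totalEdges (tuples-totalEdges n 1)
tuples-totalEdges (suc n) (suc h) =
  ++⁺ (map⁺ (tuples-totalEdges (suc n) h)) (graft-totalEdges (tuples-totalEdges n (suc (suc h))))

∈-tuples : ∀ n h (v : ForestTuple h) → totalEdges v ≡ n → v ∈ tuples n h
∈-tuples zero    h       v                    eq rewrite totalEdges≡0⇒replicate v eq = here refl
∈-tuples (suc n) zero    ([] ∷ [])            ()
∈-tuples (suc n) (suc h) ([] ∷ v)             eq = ∈-++⁺ˡ (∈-map⁺ ([] ∷_) (∈-tuples (suc n) h v eq))
∈-tuples (suc n) zero    ((node cs ∷ f) ∷ fs) eq =
  ∈-map⁺ graft (∈-tuples n 1 (cs ∷ f ∷ fs) (totalEdges-graft⁻ (cs ∷ f ∷ fs) eq))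
∈-tuples (suc n) (suc h) ((node cs ∷ f) ∷ fs) eq = ∈-++⁺ʳ (map ([] ∷_) (tuples (suc n) h))
  (∈-map⁺ graft (∈-tuples n (suc (suc h)) (cs ∷ f ∷ fs) (totalEdges-graft⁻ (cs ∷ f ∷ fs) eq)))

graft-injective : ∀ {h} {v w : ForestTuple (suc h)} → graft v ≡ graft w → v ≡ w
graft-injective {v = _ ∷ _ ∷ _} {_ ∷ _ ∷ _} refl = refl

[]∷-injective : ∀ {h} {v w : ForestTuple h} → _≡_ {A = ForestTuple (suc h)} ([] ∷ v) ([] ∷ w) → v ≡ w
[]∷-injective refl = refl

tuples-unique : ∀ n h → Unique (tuples n h)
tuples-unique zero    h       = [] ∷ []
tuples-unique (suc n) zero    = Unique.map⁺ graft-injective (tuples-unique n 1)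
tuples-unique (suc n) (suc h) = Unique.++⁺ (Unique.map⁺ []∷-injective (tuples-unique (suc n) h))
  (Unique.map⁺ graft-injective (tuples-unique n (suc (suc h)))) disjoint
  where
  disjoint : ∀ {v} → v ∈ map ([] ∷_) (tuples (suc n) h) × v ∈ map graft (tuples n (suc (suc h))) → ⊥
  disjoint (p , q) with ∈-map⁻ ([] ∷_) p | ∈-map⁻ graft q
  ... | _ , _ , refl | (_ ∷ _ ∷ _) , _ , ()

root : ForestTuple 0 → PlaneTree
root (cs ∷ []) = node cs

trees : ℕ → List PlaneTree
trees n = map root (tuples n 0)

length-trees : ∀ n → length (trees n) ≡ catalan n
length-trees n = trans (length-map root (tuples n 0)) (trans (length-tuples n 0) (sym (catalan≡ballot n)))

trees-unique : ∀ n → Unique (trees n)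
trees-unique n = Unique.map⁺ root-injective (tuples-unique n 0)
  where
  root-injective : ∀ {v w} → root v ≡ root w → v ≡ w
  root-injective {_ ∷ []} {_ ∷ []} refl = refl

∈-trees⁻ : ∀ n {t} → t ∈ trees n → edges t ≡ n
∈-trees⁻ n t∈ with ∈-map⁻ root t∈
... | (cs ∷ []) , v∈ , refl = trans (sym (+-identityʳ _)) (All.lookup (tuples-totalEdges n 0) v∈)

∈-trees⁺ : ∀ n {t} → edges t ≡ n → t ∈ trees n
∈-trees⁺ n {node cs} eq = ∈-map⁺ root (∈-tuples n 0 (cs ∷ []) (trans (+-identityʳ _) eq))

index-∈-lookup : ∀ {A : Set} (xs : List A) i → index (∈-lookup {xs = xs} i) ≡ i
index-∈-lookup (_ ∷ _)  zero    = refl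
index-∈-lookup (_ ∷ xs) (suc i) = cong suc (index-∈-lookup xs i)

Σ↔Fin-length : ∀ {A : Set} {P : A → Set} {xs : List A} → Unique xs →
  (∀ {x} → Irrelevant (P x)) → (∀ {x} → P x ⇔ x ∈ xs) → Σ A P ↔ Fin (length xs)
Σ↔Fin-length {A} {P} {xs} unique irrelevant P⇔∈ = mk↔ₛ′ (index ∘ to P⇔∈ ∘ proj₂) fromFin
  (λ i → trans (cong index (unique⇒irrelevant unique _ _)) (index-∈-lookup xs i))
  (λ (x , px) → Σ-≡ (sym (lookup-index (to P⇔∈ px))) _ px)
  where
  open Equivalence
  fromFin : Fin (length xs) → Σ A P
  fromFin i = lookup xs i , from P⇔∈ (∈-lookup i)
  Σ-≡ : ∀ {x y} → x ≡ y → (px : P x) (py : P y) → (x , px) ≡ (y , py)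
  Σ-≡ refl px py = cong (_ ,_) (irrelevant px py)

_≟ˡ_ : ∀ {m} → DecidableEquality (Letter m)
_≟ˡ_ = ≡-dec× _≟ᶠ_ _≟ᵇ_

complAt? : ∀ {m} (xs : List (Letter m)) → Decidable (ComplAt xs)
complAt? xs (i , j) with at xs i
... | nothing = no λ ()
... | just a with ≡-decMaybe _≟ˡ_ (at xs j) (just (complement a))
...   | yes eq = yes (a , refl , eq)
...   | no neq = no λ (b , eq₁ , eq₂) →
  neq (subst (λ c → at xs j ≡ just (complement c)) (sym (just-injective eq₁)) eq₂)

complAt-irrelevant : ∀ {m} (xs : List (Letter m)) {p} → Irrelevant (ComplAt xs p)
complAt-irrelevant xs (a , eq₁ , eq₂) (b , eq₁′ , eq₂′) with just-injective (trans (sym eq₁) eq₁′)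
... | refl = cong₂ (λ e e′ → a , e , e′) (≡-irrelevant eq₁ eq₁′) (≡-irrelevant eq₂ eq₂′)

module _ {m n : ℕ} (P : Word m n) where

  valid? : Decidable (Valid {m} {n} P)
  valid? t = all? (complAt? (toList P)) (edgePairs 0 t)

  valid-irrelevant : ∀ {t} → Irrelevant (Valid {m} {n} P t)
  valid-irrelevant = All.irrelevant (complAt-irrelevant (toList P))

  validTrees : List PlaneTree
  validTrees = filter valid? (trees n)

  V↔validTrees : V {m} {n} P ↔ Fin (length validTrees)
  V↔validTrees = Σ↔Fin-length (Unique.filter⁺ valid? (trees-unique n))
    (λ {t} (e , v) (e′ , v′) → cong₂ _,_ (≡-irrelevant e e′) (valid-irrelevant {t} v v′))
    (mk⇔ (λ (e , v) → ∈-filter⁺ valid? (∈-trees⁺ n e) v)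
         (λ t∈ → Product.map (∈-trees⁻ n) id (∈-filter⁻ valid? {xs = trees n} t∈)))

length-filter≡⇒All : ∀ {A : Set} {P : A → Set} (P? : Decidable P) xs →
  length (filter P? xs) ≡ length xs → All P xs
length-filter≡⇒All P? xs eq with all? P? xs
... | yes all = all
... | no ¬all = contradiction eq (λ eq → <-irrefl eq (filter-notAll P? xs (¬All⇒Any¬ P? xs ¬all)))

V↔catalan⇔allValid : ∀ {m n} (P : Word m n) → (V {m} {n} P ↔ Fin (catalan n)) ⇔ All (Valid {m} {n} P) (trees n)
V↔catalan⇔allValid {m} {n} P = mk⇔
  (λ V↔ → length-filter≡⇒All (valid? {m} {n} P) (trees n)
    (sym (trans (length-trees n) (↔⇒≡ (↔-trans (↔-sym V↔) (V↔validTrees P))))))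
  (λ all → subst (λ k → V {m} {n} P ↔ Fin k)
    (trans (cong length (filter-all (valid? {m} {n} P) all)) (length-trees n)) (V↔validTrees P))

complement-involutive : ∀ {m} (a : Letter m) → complement (complement a) ≡ a
complement-involutive (_ , true)  = refl
complement-involutive (_ , false) = refl

alternating : ∀ {m} → Letter m → (l : ℕ) → Vec (Letter m) l
alternating a zero    = []
alternating a (suc l) = a ∷ alternating (complement a) l

at-alternating-even : ∀ {m} (a : Letter m) l d → 2 * d < l → at (toList (alternating a l)) (2 * d) ≡ just a
at-alternating-even a (suc l)       zero    _ = refl
at-alternating-even a l             (suc d) lt rewrite 2[1+n]≡2+2n d with l | lt
... | suc (suc l) | s≤s (s≤s lt) =
  trans (at-alternating-even (complement (complement a)) l d lt) (cong just (complement-involutive a))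

alternating-complAt : ∀ {m} (a : Letter m) l i d → suc (i + 2 * d) < l →
  ComplAt (toList (alternating a l)) (i , suc (i + 2 * d))
alternating-complAt a (suc l) zero    d (s≤s lt) = a , refl , at-alternating-even (complement a) l d lt
alternating-complAt a (suc l) (suc i) d (s≤s lt) = alternating-complAt (complement a) l i d lt

module _ {m} (a : Letter m) (l : ℕ) where

  mutual
    edgePairs-complAt-alternating : ∀ k t → k + 2 * edges t ≤ l →
      All (ComplAt (toList (alternating a l))) (edgePairs k t)
    edgePairs-complAt-alternating k (node cs) = edgePairsF-complAt-alternating k cs

    edgePairsF-complAt-alternating : ∀ k cs → k + 2 * edgesF cs ≤ l →
      All (ComplAt (toList (alternating a l))) (edgePairsF k cs)
    edgePairsF-complAt-alternating k []       _  = []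
    edgePairsF-complAt-alternating k (c ∷ cs) le =
      ++⁺ (alternating-complAt a l k (edges c) lt ∷ edgePairs-complAt-alternating (suc k) c (≤-trans (n≤1+n _) lt))
          (edgePairsF-complAt-alternating (suc (suc (k + 2 * edges c))) cs le′)
      where
      k+2[1+e+E]≡2+k+2e+2E : ∀ k e E → k + 2 * suc (e + E) ≡ suc (suc (k + 2 * e)) + 2 * E
      k+2[1+e+E]≡2+k+2e+2E = solve-∀
      le′ : suc (suc (k + 2 * edges c)) + 2 * edgesF cs ≤ l
      le′ = subst (_≤ l) (k+2[1+e+E]≡2+k+2e+2E k (edges c) (edgesF cs)) le
      lt : suc (k + 2 * edges c) < l
      lt = ≤-trans (m≤m+n _ _) le′

alternating-valid : ∀ {m n} (a : Letter m) t → edges t ≡ n → Valid {m} {n} (alternating a (2 * n)) t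
alternating-valid {n = n} a t eq = edgePairs-complAt-alternating a (2 * n) 0 t (≤-reflexive (cong (2 *_) eq))

leaves : ℕ → List PlaneTree
leaves n = replicate n (node [])

edgesF-leaves : ∀ n → edgesF (leaves n) ≡ n
edgesF-leaves zero    = refl
edgesF-leaves (suc n) = cong suc (edgesF-leaves n)

adjacentEdgeForest : ∀ n i → suc i < 2 * n →
  Σ (List PlaneTree) λ cs → edgesF cs ≡ n × (∀ k → (k + i , suc (k + i)) ∈ edgePairsF k cs)
adjacentEdgeForest (suc n) zero _ =
  leaves (suc n) , cong suc (edgesF-leaves n) , λ k → here (cong (_, suc (k + 0)) (+-identityʳ k))
adjacentEdgeForest (suc zero) (suc zero) (s≤s (s≤s ()))
adjacentEdgeForest (suc (suc n)) (suc zero) _ =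
  node (node [] ∷ []) ∷ leaves n , cong (2 +_) (edgesF-leaves n) ,
  λ k → there (here (cong₂ _,_ (+-comm k 1) (cong suc (trans (+-comm k 1) (sym (cong suc (+-identityʳ k)))))))
adjacentEdgeForest (suc zero) (suc (suc i)) (s≤s (s≤s ()))
adjacentEdgeForest (suc (suc n)) (suc (suc i)) lt
  with cs , eq , ∈cs ← adjacentEdgeForest (suc n) i
       (≤-pred (≤-pred (subst (suc (suc (suc (suc i))) ≤_) (2[1+n]≡2+2n (suc n)) lt))) =
  node [] ∷ cs , cong suc eq ,
  λ k → there (subst (λ j → (j , suc j) ∈ edgePairsF (suc (suc (k + 0))) cs)
                      (2+k+0+i≡k+2+i k i) (∈cs (suc (suc (k + 0)))))
  where
  2+k+0+i≡k+2+i : ∀ k i → suc (suc (k + 0)) + i ≡ k + suc (suc i)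
  2+k+0+i≡k+2+i = solve-∀

allValid⇒adjacentComplAt : ∀ {m n} (P : Word m n) → (∀ t → edges t ≡ n → Valid {m} {n} P t) →
  ∀ i → suc i < 2 * n → ComplAt (toList P) (i , suc i)
allValid⇒adjacentComplAt {n = n} P valid i lt with cs , eq , ∈cs ← adjacentEdgeForest n i lt =
  All.lookup (valid (node cs) eq) (∈cs 0)

adjacentComplAt⇒alternating : ∀ {m l} (a : Letter m) (v : Vec (Letter m) l) →
  (∀ i → suc i < suc l → ComplAt (toList (a ∷ v)) (i , suc i)) → a ∷ v ≡ alternating a (suc l)
adjacentComplAt⇒alternating a []      _     = refl
adjacentComplAt⇒alternating a (b ∷ v) compl
  with _ , eq₁ , eq₂ ← compl 0 (s≤s (s≤s z≤n))
  with refl ← just-injective eq₁ | refl ← just-injective eq₂ =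
  cong (a ∷_) (adjacentComplAt⇒alternating (complement a) v λ i lt → compl (suc i) (s≤s lt))

length-cartesianProduct : ∀ {A B : Set} (xs : List A) (ys : List B) →
  length (cartesianProduct xs ys) ≡ length xs * length ys
length-cartesianProduct []       ys = refl
length-cartesianProduct (x ∷ xs) ys =
  trans (length-++ (map (x ,_) ys)) (cong₂ _+_ (length-map (x ,_) ys) (length-cartesianProduct xs ys))

letters : (m : ℕ) → List (Letter m)
letters m = cartesianProduct (allFin m) (true ∷ false ∷ [])

length-letters : ∀ m → length (letters m) ≡ 2 * m
length-letters m = trans (length-cartesianProduct (allFin m) _)
  (trans (cong (_* 2) (length-tabulate {n = m} (λ i → i))) (*-comm m 2))

letters-unique : ∀ m → Unique (letters m)
letters-unique m = Unique.cartesianProduct⁺ (Unique.allFin⁺ m) (((λ ()) ∷ []) ∷ [] ∷ [])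

∈-letters : ∀ {m} (a : Letter m) → a ∈ letters m
∈-letters (i , true)  = ∈-cartesianProduct⁺ (∈-allFin i) (here refl)
∈-letters (i , false) = ∈-cartesianProduct⁺ (∈-allFin i) (there (here refl))

alternatingWords : (n m : ℕ) → List (Word m n)
alternatingWords n m = map (λ a → alternating a (2 * n)) (letters m)

length-alternatingWords : ∀ n m → length (alternatingWords n m) ≡ 2 * m
length-alternatingWords n m = trans (length-map _ (letters m)) (length-letters m)

alternatingWords-unique : ∀ n m → Unique (alternatingWords (suc n) m)
alternatingWords-unique n m = Unique.map⁺ (cong head) (letters-unique m)

∈-alternatingWords⇒allValid : ∀ {m n} (P : Word m n) → P ∈ alternatingWords n m → All (Valid {m} {n} P) (trees n)
∈-alternatingWords⇒allValid {n = n} P P∈ with a , _ , refl ← ∈-map⁻ _ P∈ =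
  All.tabulate λ {t} t∈ → alternating-valid {n = n} a t (∈-trees⁻ n t∈)

allValid⇒∈-alternatingWords : ∀ {m n} (P : Word m (suc n)) → All (Valid {m} {suc n} P) (trees (suc n)) →
  P ∈ alternatingWords (suc n) m
allValid⇒∈-alternatingWords {m} {n} (b ∷ v) allValid =
  subst (_∈ alternatingWords (suc n) m)
    (sym (adjacentComplAt⇒alternating b v (allValid⇒adjacentComplAt (b ∷ v) valid)))
    (∈-map⁺ _ (∈-letters b))
  where
  valid : ∀ t → edges t ≡ suc n → Valid {m} {suc n} (b ∷ v) t
  valid t eq = All.lookup allValid (∈-trees⁺ (suc n) {t} eq)

∈-alternatingWords⇔allValid : ∀ {m n} (P : Word m (suc n)) →
  P ∈ alternatingWords (suc n) m ⇔ All (Valid {m} {suc n} P) (trees (suc n))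
∈-alternatingWords⇔allValid {m} {n} P =
  mk⇔ (∈-alternatingWords⇒allValid {m} {suc n} P) (allValid⇒∈-alternatingWords {m} {n} P)

-- 1 ≤ n makes an alternating word determined by its first letter.
mainTheorem9 : (n m : ℕ) → 1 ≤ n → 1 ≤ m →
    Σ (List (Word m n)) λ L →
      Unique L × length L ≡ 2 * m ×
      ((P : Word m n) → (P ∈ L) ⇔ (V {m} {n} P ↔ Fin (catalan n)))
mainTheorem9 (suc n) m _ _ =
  alternatingWords (suc n) m , alternatingWords-unique n m , length-alternatingWords (suc n) m ,
  λ P → ⇔.trans (∈-alternatingWords⇔allValid P) (⇔.sym (V↔catalan⇔allValid {m} {suc n} P))
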